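{- Let $P=(X,\le)$ be a poset and $\mathcal{M}$ a collection of subsets of $X$ containing all singletons. If $\ll_{\mathcal{M}}$ has the interpolation property, then $\twoheaduparrow_{\mathcal{M}} Y\in\sigma_{\mathcal{M}}$ for all $Y\subseteq X$.
   Context: $\mathcal{M}_\vee$ is the set of members of $\mathcal{M}$ with a supremum. $x\ll_{\mathcal{M}} y$ iff for all $M\in\mathcal{M}_\vee$, $y\le\bigvee M$ implies $x\in\downarrow M$. Interpolation property: $x\ll_{\mathcal{M}} z$ implies $x\ll_{\mathcal{M}} y\ll_{\mathcal{M}} z$ for some $y$. $\twoheaduparrow_{\mathcal{M}} Y=\{x:\exists y\in Y,\ y\ll_{\mathcal{M}} x\}$. $\sigma_{\mathcal{M}}=\{U:U=\uparrow U,\ \forall M\in\mathcal{M}_\vee(\bigvee M\in U\Rightarrow U\cap M\ne\varnothing)\}$. -}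

module Defs where

open import Level using (Level; _⊔_; suc)
open import Data.Product using (Σ; _×_; _,_; ∃-syntax)
open import Relation.Unary using (Pred; _∈_; _∩_; Satisfiable)
open import Relation.Binary.Bundles using (Poset)

module _ {c ℓ₁ ℓ₂ : Level} (P : Poset c ℓ₁ ℓ₂) where
  open Poset P renaming (Carrier to X)

  ｛_｝ : X → Pred X ℓ₁
  ｛ x ｝ = λ y → y ≈ x

  IsSup : {ℓ : Level} → Pred X ℓ → X → Set (c ⊔ ℓ ⊔ ℓ₂)
  IsSup M s = (∀ m → m ∈ M → m ≤ s)
            × (∀ u → (∀ m → m ∈ M → m ≤ u) → s ≤ u)

  ↓ : {ℓ : Level} → Pred X ℓ → Pred X (c ⊔ ℓ ⊔ ℓ₂)
  ↓ M x = ∃[ m ] (m ∈ M × x ≤ m)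

  IsUpper : {ℓ : Level} → Pred X ℓ → Set (c ⊔ ℓ ⊔ ℓ₂)
  IsUpper U = ∀ x y → x ≤ y → x ∈ U → y ∈ U

  module _ {ℓ' : Level} (𝓜 : Pred (Pred X ℓ₁) ℓ') where

    -- x ≪_𝓜 y: for all M ∈ 𝓜 having a supremum s, y ≤ s implies x ∈ ↓M
    -- (ranging over all suprema s of M; suprema are unique up to ≈)
    _≪_ : X → X → Set (c ⊔ ℓ₂ ⊔ suc ℓ₁ ⊔ ℓ')
    x ≪ y = ∀ (M : Pred X ℓ₁) → M ∈ 𝓜 → ∀ s → IsSup M s → y ≤ s → x ∈ ↓ M

    Interpolation : Set (c ⊔ ℓ₂ ⊔ suc ℓ₁ ⊔ ℓ')
    Interpolation = ∀ x z → x ≪ z → ∃[ y ] (x ≪ y × y ≪ z)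

    ↠ : {ℓY : Level} → Pred X ℓY → Pred X (c ⊔ ℓ₂ ⊔ suc ℓ₁ ⊔ ℓ' ⊔ ℓY)
    ↠ Y x = ∃[ y ] (y ∈ Y × y ≪ x)

    Inσ : {ℓU : Level} → Pred X ℓU → Set (c ⊔ ℓ₂ ⊔ suc ℓ₁ ⊔ ℓ' ⊔ ℓU)
    Inσ U = IsUpper U
          × (∀ (M : Pred X ℓ₁) → M ∈ 𝓜 → ∀ s → IsSup M s → s ∈ U → Satisfiable (U ∩ M))

    ContainsSingletons : Set (c ⊔ ℓ')
    ContainsSingletons = ∀ x → ｛ x ｝ ∈ 𝓜

module Submission where

-- Write ≪ for ≪_𝓜 and ↠Y = { x : ∃ y ∈ Y, y ≪ x }.
--  * ≪ is stable under enlarging its right argument: if a ≪ x ≤ x', then the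
--    supremum of any M ∈ 𝓜 lying above x' also lies above x, so a ≪ x'.
--    Hence ↠Y is an upper set.
--  * Let M ∈ 𝓜 have supremum s ∈ ↠Y, say y ∈ Y with y ≪ s.  Interpolate
--    y ≪ z ≪ s.  Applying z ≪ s to M itself (s ≤ ⋁M) gives m ∈ M with z ≤ m,
--    so y ≪ z ≤ m yields y ≪ m, i.e. m ∈ ↠Y ∩ M.

open import Defs
open import Level using (Level; _⊔_; suc)
open import Relation.Unary using (Pred; _∈_; _∩_; Satisfiable)
open import Relation.Binary.Bundles using (Poset)
open import Data.Product using (_,_)

module _ {c ℓ₁ ℓ₂ ℓ' : Level} (P : Poset c ℓ₁ ℓ₂)
         (𝓜 : Pred (Pred (Poset.Carrier P) ℓ₁) ℓ') where
  open Poset P renaming (Carrier to X)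

  private
    _≪𝓜_ : X → X → Set (c ⊔ ℓ₂ ⊔ suc ℓ₁ ⊔ ℓ')
    _≪𝓜_ = _≪_ P 𝓜

  ≪-≤-trans : ∀ {a x x'} → a ≪𝓜 x → x ≤ x' → a ≪𝓜 x'
  ≪-≤-trans a≪x x≤x' M M∈𝓜 s sup x'≤s = a≪x M M∈𝓜 s sup (trans x≤x' x'≤s)

  ↠-isUpper : ∀ {ℓY} (Y : Pred X ℓY) → IsUpper P (↠ P 𝓜 Y)
  ↠-isUpper Y x x' x≤x' (y , y∈Y , y≪x) = y , y∈Y , ≪-≤-trans y≪x x≤x'

  ↠-inaccessible : Interpolation P 𝓜 → ∀ {ℓY} (Y : Pred X ℓY) →
    ∀ (M : Pred X ℓ₁) → M ∈ 𝓜 → ∀ s → IsSup P M s → s ∈ ↠ P 𝓜 Y →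
    Satisfiable (↠ P 𝓜 Y ∩ M)
  ↠-inaccessible interp Y M M∈𝓜 s sup (y , y∈Y , y≪s)
    with interp y s y≪s
  ... | z , y≪z , z≪s with z≪s M M∈𝓜 s sup refl
  ...   | m , m∈M , z≤m = m , (y , y∈Y , ≪-≤-trans y≪z z≤m) , m∈M

lemma3p13 : {c ℓ₁ ℓ₂ ℓ' ℓY : Level} (P : Poset c ℓ₁ ℓ₂)
    (𝓜 : Pred (Pred (Poset.Carrier P) ℓ₁) ℓ') →
    ContainsSingletons P 𝓜 →
    Interpolation P 𝓜 →
    (Y : Pred (Poset.Carrier P) ℓY) →
    Inσ P 𝓜 (↠ P 𝓜 Y)
lemma3p13 P 𝓜 _ interp Y = ↠-isUpper P 𝓜 Y , ↠-inaccessible P 𝓜 interp Y
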